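{- Let $(G,c,k)$ be an instance of \textsc{Multi-STC}, let $A\subseteq\mathscr{P}$, let $L$ be an STC-labeling of $G$, and let $e\in W_L\cap E(A)$. Let $P=(v_1,v_2,\dots,v_r)$ be an edge-simple path in $G[A]$ with $\{v_1,v_2\}=e$ and color sequence $Q_L^P=(q_1=0,q_2,\dots,q_{r-1})$ under $L$. Then there exists an STC-labeling $L'$ of $G$ that is partially equal to $L$ on $E\setminus E(P)$ such that $Q_{L'}^P=(q_2,q_3,\dots,q_{r-1},0)$ or $|W_{L'}|<|W_L|$.
   Context: A $c$-colored labeling of $G=(V,E)$ is a partition $L=(S^1_L,\dots,S^c_L,W_L)$ of $E$; it is an STC-labeling if there are no $\{u,v\},\{v,w\}\in S^i_L$ ($u\ne w$) with $\{u,w\}\notin E$. Fix $D\subseteq E$ such that $(V,E\setminus D)$ has maximum degree at most $\lfloor c/2\rfloor+1$; the core $\mathscr{C}$ is the set of vertices incident with an edge of $D$ and $\mathscr{P}=V\setminus\mathscr{C}$ (so every vertex of $\mathscr{P}$ has degree at most $\lfloor c/2\rfloor+1$ in $G$). $E(A)$ denotes edges with both endpoints in $A$. A path is edge-simple if no edge is traversed twice; $E(P)$ is its edge set. The color sequence of a path $P$ under $L$ lists, for each consecutive edge of $P$ in order, the index $i$ of its strong class $S^i_L$, or $0$ if it is weak. Labelings $L,L'$ are partially equal on $E'$ if for all $e\in E'$ and all $i$, $e\in S^i_L\iff e\in S^i_{L'}$. -}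

module Defs where

open import Data.Bool using (Bool; true; false; T; _∧_; not; if_then_else_)
open import Data.Nat using (ℕ; zero; suc; _+_; _≤_; _<_; _/_)
open import Data.Fin using (Fin; toℕ) renaming (zero to fzero; suc to fsuc)
open import Data.Fin.Properties using () renaming (_≟_ to _≟F_)
open import Data.List using (List; []; _∷_; map; allFin; drop; _++_; [_])
open import Data.Nat.ListAction using (sum)
open import Data.List.Relation.Unary.All using (All)
open import Data.List.Relation.Unary.Any using (Any)
open import Data.List.Relation.Unary.AllPairs using (AllPairs)
open import Data.Product using (_×_; _,_; ∃; Σ-syntax)
open import Data.Sum using (_⊎_)
open import Relation.Binary.PropositionalEquality using (_≡_; _≢_)
open import Relation.Nullary using (¬_; does)

record Graph (n : ℕ) : Set where
  field
    adj   : Fin n → Fin n → Bool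
    sym   : ∀ u v → adj u v ≡ adj v u
    irrefl : ∀ v → adj v v ≡ false
open Graph public

Edge : ∀ {n} → Graph n → Fin n → Fin n → Set
Edge G u v = T (adj G u v)

-- A c-colored labeling: each (unordered) pair gets a label in Fin (suc c);
-- label fzero means "weak" (class W_L), label fsuc i means strong class S^(i+1).
-- Only the values on edges of G are meaningful.
record Labeling (n c : ℕ) : Set where
  field
    lab    : Fin n → Fin n → Fin (suc c)
    labSym : ∀ u v → lab u v ≡ lab v u
open Labeling public

IsSTC : ∀ {n c} → Graph n → Labeling n c → Set
IsSTC G L = ∀ u v w (i : Fin _) → u ≢ w → Edge G u v → Edge G v w →
            lab L u v ≡ fsuc i → lab L v w ≡ fsuc i → Edge G u w

isWeak : ∀ {c} → Fin (suc c) → Bool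
isWeak fzero    = true
isWeak (fsuc _) = false

sumOver : ∀ {n} → (Fin n → ℕ) → ℕ
sumOver {n} f = sum (map f (allFin n))

count : ∀ {n} → (Fin n → Bool) → ℕ
count p = sumOver (λ x → if p x then 1 else 0)

weakCount : ∀ {n c} → Graph n → Labeling n c → ℕ
weakCount G L = sumOver (λ u → count (λ v →
  does (suc (toℕ u) Data.Nat.≤? toℕ v) ∧ adj G u v ∧ isWeak (lab L u v)))

degMinus : ∀ {n} → Graph n → (Fin n → Fin n → Bool) → Fin n → ℕ
degMinus G D v = count (λ w → adj G v w ∧ not (D v w))

ValidD : ∀ {n} → Graph n → ℕ → (Fin n → Fin n → Bool) → Set
ValidD G c D = (∀ u v → D u v ≡ D v u)
             × (∀ u v → T (D u v) → Edge G u v)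
             × (∀ v → degMinus G D v ≤ c / 2 + 1)

InCore : ∀ {n} → (Fin n → Fin n → Bool) → Fin n → Set
InCore D v = ∃ λ w → T (D v w)

InPeriphery : ∀ {n} → (Fin n → Fin n → Bool) → Fin n → Set
InPeriphery D v = ¬ InCore D v

steps : ∀ {A : Set} → List A → List (A × A)
steps []            = []
steps (x ∷ [])      = []
steps (x ∷ y ∷ xs)  = (x , y) ∷ steps (y ∷ xs)

SameEdge : ∀ {n} → Fin n × Fin n → Fin n × Fin n → Set
SameEdge (a , b) (c , d) = (a ≡ c × b ≡ d) ⊎ (a ≡ d × b ≡ c)

WalkIn : ∀ {n} → Graph n → (Fin n → Set) → List (Fin n) → Set
WalkIn G A P = All A P × All (λ e → Edge G (Data.Product.proj₁ e) (Data.Product.proj₂ e)) (steps P)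

EdgeSimple : ∀ {n} → List (Fin n) → Set
EdgeSimple P = AllPairs (λ e f → ¬ SameEdge e f) (steps P)

InPathEdges : ∀ {n} → List (Fin n) → Fin n → Fin n → Set
InPathEdges P u v = Any (SameEdge (u , v)) (steps P)

colorSeq : ∀ {n c} → Labeling n c → List (Fin n) → List (Fin (suc c))
colorSeq L P = map (λ e → lab L (Data.Product.proj₁ e) (Data.Product.proj₂ e)) (steps P)

PartEqOff : ∀ {n c} → Graph n → List (Fin n) → Labeling n c → Labeling n c → Set
PartEqOff G P L L' = ∀ u v → Edge G u v → ¬ InPathEdges P u v → lab L u v ≡ lab L' u v

module Submission where

-- The proof walks along the path P = v₁ v₂ … v_r and repeatedly applies a
-- local exchange on two consecutive path edges ab, bd where ab is weak:
-- either ab takes over the label of bd and bd becomes weak (weak count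
-- unchanged), or some strong colour can be given to ab directly, which
-- strictly decreases the number of weak edges.  The exchange rests on:
--   * weak-count accounting: relabelling one edge changes |W| only by the
--     change of weakness of that edge (a point-update identity for sums);
--   * STC preservation: making an edge weak is always safe, and colouring
--     ab with i is safe when i is "free" for ab (no i-coloured neighbour
--     of a or b outside the common neighbourhood);
--   * a pigeonhole count: if ab and bd are weak and deg a + deg b ≤ c + 2
--     (true for periphery vertices), some colour is free for ab, because
--     conflicts for all c colours plus the three weak slots b, a, d would
--     give c + 3 distinct neighbour slots of a and b.

open import Defs renaming (sym to adjSym)
open import Data.Nat using (ℕ; suc; _<_)
open import Data.Bool using (Bool)
open import Data.Fin using (Fin) renaming (zero to fzero)
open import Data.List using (List; _∷_; drop; _++_; [_])
open import Data.Product using (_×_; Σ-syntax)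
open import Data.Sum using (_⊎_)
open import Relation.Binary.PropositionalEquality using (_≡_)

open import Data.Bool using (true; false; T; _∧_; not; if_then_else_)
open import Data.Bool.Properties using (∧-identityʳ; T-≡)
open import Function.Bundles using (Equivalence)
open import Data.Nat using (_+_; _*_; _≤_; _/_)
open import Data.Nat.Properties
open import Data.Nat.DivMod using (m/n*n≤m)
open import Data.Nat.ListAction using (sum)
open import Data.Fin using (toℕ; splitAt; join) renaming (suc to fsuc)
open import Data.Fin.Properties
  using (toℕ-injective; injective⇒≤; any?; join-splitAt) renaming (suc-injective to fsuc-injective; _≟_ to _≟F_)
open import Data.Vec.Functional using () renaming (_++_ to _⧺_)
open import Data.List using ([]; map; allFin; length; lookup; filterᵇ)
open import Data.List.Properties using (map-tabulate; map-cong; length-map; length-++)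
open import Data.List.Membership.Propositional using (_∈_)
open import Data.List.Membership.Propositional.Properties using (∈-allFin; ∈-map⁺; ∈-++⁺ˡ; ∈-++⁺ʳ; ∈-filter⁺)
open import Data.List.Relation.Unary.Any using (here; there; index)
open import Data.List.Relation.Unary.Any.Properties using (lookup-index)
open import Data.List.Relation.Unary.All using (All; []; _∷_)
open import Data.List.Relation.Unary.All.Properties using (All¬⇒¬Any)
open import Data.List.Relation.Unary.AllPairs using (_∷_)
open import Data.Product using (_,_; proj₁; proj₂)
open import Data.Sum using (inj₁; inj₂; [_,_]′)
open import Data.Empty using (⊥-elim)
open import Function using (_∘_; id)
open import Function.Definitions using (Injective)
open import Relation.Binary.PropositionalEquality using (_≢_; refl; sym; trans; cong; cong₂; subst; module ≡-Reasoning)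
open import Relation.Binary.Definitions using (tri<; tri≈; tri>)
open import Relation.Nullary using (¬_; Dec; yes; no; does)
open import Relation.Nullary.Decidable using (_×-dec_; _⊎-dec_; dec-true; dec-false; ¬?; T?)
open import Data.Nat.Solver using (module +-*-Solver)
open +-*-Solver using (solve; _:+_; _:*_; _:=_; con)

indicator : Bool → ℕ
indicator b = if b then 1 else 0

edge-irrefl : ∀ {n} (G : Graph n) {a b : Fin n} → Edge G a b → a ≢ b
edge-irrefl G {a} e refl = subst T (irrefl G a) e

edge-sym : ∀ {n} (G : Graph n) {a b : Fin n} → Edge G a b → Edge G b a
edge-sym G {a} {b} = subst T (adjSym G a b)

sumOver-suc : ∀ {n} (f : Fin (suc n) → ℕ) → sumOver f ≡ f fzero + sumOver (f ∘ fsuc)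
sumOver-suc {n} f = cong (λ l → f fzero + sum l)
  (trans (map-tabulate fsuc f) (sym (map-tabulate id (f ∘ fsuc))))

sumOver-cong : ∀ {n} {f g : Fin n → ℕ} → (∀ x → f x ≡ g x) → sumOver f ≡ sumOver g
sumOver-cong {n} h = cong sum (map-cong h (allFin n))

-- Changing a summand at one point x changes the sum by exactly that change
-- (stated additively to stay within ℕ).
sumOver-pointUpdate : ∀ {n} (F F' : Fin n → ℕ) (x : Fin n) → (∀ u → u ≢ x → F u ≡ F' u)
                    → sumOver F + F' x ≡ sumOver F' + F x
sumOver-pointUpdate {suc m} F F' fzero agree = begin
    sumOver F + F' fzero                            ≡⟨ cong (_+ F' fzero) (sumOver-suc F) ⟩
    (F fzero + sumOver (F ∘ fsuc)) + F' fzero       ≡⟨ cong (λ s → (F fzero + s) + F' fzero) rest ⟩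
    (F fzero + sumOver (F' ∘ fsuc)) + F' fzero      ≡⟨ swap3 (F fzero) (sumOver (F' ∘ fsuc)) (F' fzero) ⟩
    (F' fzero + sumOver (F' ∘ fsuc)) + F fzero      ≡⟨ cong (_+ F fzero) (sym (sumOver-suc F')) ⟩
    sumOver F' + F fzero                            ∎
  where
  open ≡-Reasoning
  rest : sumOver (F ∘ fsuc) ≡ sumOver (F' ∘ fsuc)
  rest = sumOver-cong (λ u → agree (fsuc u) (λ ()))
  swap3 : ∀ a s a' → (a + s) + a' ≡ (a' + s) + a
  swap3 = solve 3 (λ a s a' → (a :+ s) :+ a' := (a' :+ s) :+ a) refl
sumOver-pointUpdate {suc m} F F' (fsuc y) agree = begin
    sumOver F + F' (fsuc y)                                  ≡⟨ cong (_+ F' (fsuc y)) (sumOver-suc F) ⟩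
    (F fzero + sumOver (F ∘ fsuc)) + F' (fsuc y)             ≡⟨ +-assoc (F fzero) _ _ ⟩
    F fzero + (sumOver (F ∘ fsuc) + F' (fsuc y))             ≡⟨ cong₂ _+_ (agree fzero (λ ())) ih ⟩
    F' fzero + (sumOver (F' ∘ fsuc) + F (fsuc y))            ≡⟨ sym (+-assoc (F' fzero) _ _) ⟩
    (F' fzero + sumOver (F' ∘ fsuc)) + F (fsuc y)            ≡⟨ cong (_+ F (fsuc y)) (sym (sumOver-suc F')) ⟩
    sumOver F' + F (fsuc y)                                  ∎
  where
  open ≡-Reasoning
  ih : sumOver (F ∘ fsuc) + F' (fsuc y) ≡ sumOver (F' ∘ fsuc) + F (fsuc y)
  ih = sumOver-pointUpdate (F ∘ fsuc) (F' ∘ fsuc) y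
         (λ u u≢y → agree (fsuc u) (u≢y ∘ fsuc-injective))

-- Composing two additive exchanges: S - S' = r - r' and r - r' = p - q.
exchange-trans : ∀ S S' r r' p q → S + r' ≡ S' + r → r + p ≡ r' + q → S + p ≡ S' + q
exchange-trans S S' r r' p q e₁ e₂ = +-cancelʳ-≡ (r + r') (S + p) (S' + q) (begin
    (S + p) + (r + r')   ≡⟨ regroup S p r r' ⟩
    (S + r') + (r + p)   ≡⟨ cong₂ _+_ e₁ e₂ ⟩
    (S' + r) + (r' + q)  ≡⟨ sym (regroup S' q r' r) ⟩
    (S' + q) + (r' + r)  ≡⟨ cong ((S' + q) +_) (+-comm r' r) ⟩
    (S' + q) + (r + r')  ∎)
  where
  open ≡-Reasoning
  regroup : ∀ S p r r' → (S + p) + (r + r') ≡ (S + r') + (r + p)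
  regroup = solve 4 (λ S p r r' → (S :+ p) :+ (r :+ r') := (S :+ r') :+ (r :+ p)) refl

sumOver²-pointUpdate : ∀ {n} (F F' : Fin n → Fin n → ℕ) (x y : Fin n)
  → (∀ u v → ¬ (u ≡ x × v ≡ y) → F u v ≡ F' u v)
  → sumOver (λ u → sumOver (F u)) + F' x y ≡ sumOver (λ u → sumOver (F' u)) + F x y
sumOver²-pointUpdate F F' x y agree =
  exchange-trans _ _ (sumOver (F x)) (sumOver (F' x)) (F' x y) (F x y) rows row-x
  where
  rows : sumOver (λ u → sumOver (F u)) + sumOver (F' x) ≡ sumOver (λ u → sumOver (F' u)) + sumOver (F x)
  rows = sumOver-pointUpdate (λ u → sumOver (F u)) (λ u → sumOver (F' u)) x
           (λ u u≢x → sumOver-cong (λ v → agree u v (u≢x ∘ proj₁)))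
  row-x : sumOver (F x) + F' x y ≡ sumOver (F' x) + F x y
  row-x = sumOver-pointUpdate (F x) (F' x) y (λ v v≢y → agree x v (v≢y ∘ proj₂))

module _ {n : ℕ} where

  sameEdge? : (e f : Fin n × Fin n) → Dec (SameEdge e f)
  sameEdge? (a , b) (c , d) = ((a ≟F c) ×-dec (b ≟F d)) ⊎-dec ((a ≟F d) ×-dec (b ≟F c))

  sameEdge-swapˡ : ∀ {u v : Fin n} {f} → SameEdge (u , v) f → SameEdge (v , u) f
  sameEdge-swapˡ (inj₁ (p , q)) = inj₂ (q , p)
  sameEdge-swapˡ (inj₂ (p , q)) = inj₁ (q , p)

  sameEdge-swapʳ : ∀ {e} {a b : Fin n} → SameEdge e (a , b) → SameEdge e (b , a)
  sameEdge-swapʳ (inj₁ (p , q)) = inj₂ (p , q)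
  sameEdge-swapʳ (inj₂ (p , q)) = inj₁ (p , q)

  sameEdge-sym : ∀ {e f : Fin n × Fin n} → SameEdge e f → SameEdge f e
  sameEdge-sym (inj₁ (p , q)) = inj₁ (sym p , sym q)
  sameEdge-sym (inj₂ (p , q)) = inj₂ (sym q , sym p)

  sameEdge-pivot : ∀ {u v w a b : Fin n} → SameEdge (u , v) (a , b) → SameEdge (v , w) (a , b) → u ≡ w
  sameEdge-pivot (inj₁ (refl , refl)) (inj₁ (refl , refl)) = refl
  sameEdge-pivot (inj₁ (refl , refl)) (inj₂ (refl , refl)) = refl
  sameEdge-pivot (inj₂ (refl , refl)) (inj₁ (refl , refl)) = refl
  sameEdge-pivot (inj₂ (refl , refl)) (inj₂ (refl , refl)) = refl

module _ {n c : ℕ} where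

  lab-sameEdge : (L : Labeling n c) {u v a b : Fin n} → SameEdge (u , v) (a , b) → lab L u v ≡ lab L a b
  lab-sameEdge L (inj₁ (refl , refl)) = refl
  lab-sameEdge L (inj₂ (refl , refl)) = labSym L _ _

  relabel : Labeling n c → Fin n → Fin n → Fin (suc c) → Labeling n c
  relabel L a b z = record { lab = newLab ; labSym = newSym }
    where
    newLab : Fin n → Fin n → Fin (suc c)
    newLab u v with sameEdge? (u , v) (a , b)
    ... | yes _ = z
    ... | no _  = lab L u v
    newSym : ∀ u v → newLab u v ≡ newLab v u
    newSym u v with sameEdge? (u , v) (a , b) | sameEdge? (v , u) (a , b)
    ... | yes _ | yes _ = refl
    ... | no _  | no _  = labSym L u v
    ... | yes p | no q  = ⊥-elim (q (sameEdge-swapˡ p))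
    ... | no p  | yes q = ⊥-elim (p (sameEdge-swapˡ q))

  relabel-here : ∀ L a b z {u v} → SameEdge (u , v) (a , b) → lab (relabel L a b z) u v ≡ z
  relabel-here L a b z {u} {v} s with sameEdge? (u , v) (a , b)
  ... | yes _ = refl
  ... | no ns = ⊥-elim (ns s)

  relabel-ab : ∀ L a b z → lab (relabel L a b z) a b ≡ z
  relabel-ab L a b z = relabel-here L a b z (inj₁ (refl , refl))

  relabel-elsewhere : ∀ L a b z {u v} → ¬ SameEdge (u , v) (a , b) → lab L u v ≡ lab (relabel L a b z) u v
  relabel-elsewhere L a b z {u} {v} ns with sameEdge? (u , v) (a , b)
  ... | yes s = ⊥-elim (ns s)
  ... | no _  = refl

  weaken-keeps-colour : ∀ L x y {u v} {i : Fin c} → lab L x y ≢ fsuc i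
    → lab L u v ≡ fsuc i → lab (relabel L x y fzero) u v ≡ fsuc i
  weaken-keeps-colour L x y {u} {v} xy≢i uv≡i with sameEdge? (u , v) (x , y)
  ... | yes s = ⊥-elim (xy≢i (trans (sym (lab-sameEdge L s)) uv≡i))
  ... | no _  = uv≡i

module WeakCount {n : ℕ} (G : Graph n) {c : ℕ} where

  weakPair : Labeling n c → Fin n → Fin n → Bool
  weakPair M u v = does (suc (toℕ u) ≤? toℕ v) ∧ adj G u v ∧ isWeak (lab M u v)

  weakPair-edge : ∀ M {a b} → toℕ a < toℕ b → Edge G a b → weakPair M a b ≡ isWeak (lab M a b)
  weakPair-edge M {a} {b} a<b e
    rewrite dec-true (suc (toℕ a) ≤? toℕ b) a<b | Equivalence.to T-≡ e = refl

  weakCount-oneEdge< : ∀ (M M' : Labeling n c) {a b} → toℕ a < toℕ b → Edge G a b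
    → (∀ u v → ¬ SameEdge (u , v) (a , b) → lab M u v ≡ lab M' u v)
    → weakCount G M + indicator (isWeak (lab M' a b)) ≡ weakCount G M' + indicator (isWeak (lab M a b))
  weakCount-oneEdge< M M' {a} {b} a<b e agree
    rewrite sym (weakPair-edge M a<b e) | sym (weakPair-edge M' a<b e)
    = sumOver²-pointUpdate (λ u v → indicator (weakPair M u v)) (λ u v → indicator (weakPair M' u v)) a b
        (λ u v ne → cong indicator (agreeOff u v ne))
    where
    agreeOff : ∀ u v → ¬ (u ≡ a × v ≡ b) → weakPair M u v ≡ weakPair M' u v
    agreeOff u v ne with sameEdge? (u , v) (a , b)
    ... | no ns = cong (λ l → does (suc (toℕ u) ≤? toℕ v) ∧ adj G u v ∧ isWeak l) (agree u v ns)
    ... | yes (inj₁ p) = ⊥-elim (ne p)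
    ... | yes (inj₂ (refl , refl)) rewrite dec-false (suc (toℕ b) ≤? toℕ a) (<-asym a<b) = refl

  weakCount-oneEdge : ∀ (M M' : Labeling n c) {a b} → Edge G a b
    → (∀ u v → ¬ SameEdge (u , v) (a , b) → lab M u v ≡ lab M' u v)
    → weakCount G M + indicator (isWeak (lab M' a b)) ≡ weakCount G M' + indicator (isWeak (lab M a b))
  weakCount-oneEdge M M' {a} {b} e agree with <-cmp (toℕ a) (toℕ b)
  ... | tri< a<b _ _ = weakCount-oneEdge< M M' a<b e agree
  ... | tri≈ _ a≡b _ = ⊥-elim (edge-irrefl G e (toℕ-injective a≡b))
  ... | tri> _ _ b<a
    rewrite labSym M a b | labSym M' a b
    = weakCount-oneEdge< M M' b<a (edge-sym G e) (λ u v ns → agree u v (ns ∘ sameEdge-swapʳ))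

  weakCount-strengthen : ∀ M {a b} i → Edge G a b → lab M a b ≡ fzero
    → suc (weakCount G (relabel M a b (fsuc i))) ≡ weakCount G M
  weakCount-strengthen M {a} {b} i e weak = begin
      suc (weakCount G M')          ≡⟨ +-comm 1 _ ⟩
      weakCount G M' + 1            ≡⟨ cong (λ l → weakCount G M' + indicator (isWeak l)) (sym weak) ⟩
      weakCount G M' + indicator (isWeak (lab M a b)) ≡⟨ sym (weakCount-oneEdge M M' e (λ u v → relabel-elsewhere M a b (fsuc i))) ⟩
      weakCount G M + indicator (isWeak (lab M' a b)) ≡⟨ cong (λ l → weakCount G M + indicator (isWeak l)) (relabel-ab M a b (fsuc i)) ⟩
      weakCount G M + 0             ≡⟨ +-identityʳ _ ⟩
      weakCount G M                 ∎
    where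
    open ≡-Reasoning
    M' : Labeling n c
    M' = relabel M a b (fsuc i)

  weakCount-weaken : ∀ M {a b} i → Edge G a b → lab M a b ≡ fsuc i
    → weakCount G (relabel M a b fzero) ≡ suc (weakCount G M)
  weakCount-weaken M {a} {b} i e strong = begin
      weakCount G M'                ≡⟨ sym (+-identityʳ _) ⟩
      weakCount G M' + 0            ≡⟨ cong (λ l → weakCount G M' + indicator (isWeak l)) (sym strong) ⟩
      weakCount G M' + indicator (isWeak (lab M a b)) ≡⟨ sym (weakCount-oneEdge M M' e (λ u v → relabel-elsewhere M a b fzero)) ⟩
      weakCount G M + indicator (isWeak (lab M' a b)) ≡⟨ cong (λ l → weakCount G M + indicator (isWeak l)) (relabel-ab M a b fzero) ⟩
      weakCount G M + 1             ≡⟨ +-comm _ 1 ⟩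
      suc (weakCount G M)           ∎
    where
    open ≡-Reasoning
    M' : Labeling n c
    M' = relabel M a b fzero

module Closure {n : ℕ} (G : Graph n) {c : ℕ} where

  weaken-STC : ∀ L a b → IsSTC G L → IsSTC G (relabel {n} {c} L a b fzero)
  weaken-STC L a b stc u v w j u≢w e₁ e₂ l₁ l₂
    with sameEdge? (u , v) (a , b) | sameEdge? (v , w) (a , b)
  ... | yes _ | _     with () ← l₁
  ... | no _  | yes _ with () ← l₂
  ... | no _  | no _  = stc u v w j u≢w e₁ e₂ l₁ l₂

  -- A neighbour w of a, joined to a in colour i, that is not adjacent to b:
  -- it forbids giving {a,b} colour i.
  ConflictAt : Labeling n c → Fin n → Fin n → Fin c → Set
  ConflictAt M a b i = Σ[ w ∈ Fin n ] (Edge G a w × lab M a w ≡ fsuc i × ¬ Edge G b w)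

  Free : Labeling n c → Fin n → Fin n → Fin c → Set
  Free M a b i = ¬ ConflictAt M a b i × ¬ ConflictAt M b a i

  conflictAt? : ∀ M a b i → Dec (ConflictAt M a b i)
  conflictAt? M a b i = any? (λ w → T? (adj G a w) ×-dec (lab M a w ≟F fsuc i) ×-dec ¬? (T? (adj G b w)))

  free? : ∀ M a b i → Dec (Free M a b i)
  free? M a b i = ¬? (conflictAt? M a b i) ×-dec ¬? (conflictAt? M b a i)

  noConflict⇒adjacent : ∀ M {a b i} → ¬ ConflictAt M a b i
    → ∀ {w} → Edge G a w → lab M a w ≡ fsuc i → Edge G b w
  noConflict⇒adjacent M {a} {b} noConflict {w} e l with T? (adj G b w)
  ... | yes t = t
  ... | no nt = ⊥-elim (noConflict (w , e , l , nt))

  notFree⇒conflict : ∀ M a b i → ¬ Free M a b i → ConflictAt M a b i ⊎ ConflictAt M b a i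
  notFree⇒conflict M a b i notFree with conflictAt? M a b i | conflictAt? M b a i
  ... | yes ca | _     = inj₁ ca
  ... | no _   | yes cb = inj₂ cb
  ... | no na  | no nb  = ⊥-elim (notFree (na , nb))

  conflict-transfer : ∀ M M' {a b i} → (∀ {w} → lab M a w ≡ fsuc i → lab M' a w ≡ fsuc i)
    → ConflictAt M a b i → ConflictAt M' a b i
  conflict-transfer M M' keep (w , e , l , ne) = w , e , keep l , ne

  recolour-STC : ∀ L a b i → IsSTC G L → Free L a b i → IsSTC G (relabel {n} {c} L a b (fsuc i))
  recolour-STC L a b i stc (freeA , freeB) u v w j u≢w e₁ e₂ l₁ l₂
    with sameEdge? (u , v) (a , b) | sameEdge? (v , w) (a , b)
  ... | yes s₁ | yes s₂ = ⊥-elim (u≢w (sameEdge-pivot s₁ s₂))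
  ... | yes s₁ | no _   = viaFirst s₁ (trans l₂ (sym l₁))
    where
    viaFirst : SameEdge (u , v) (a , b) → lab L v w ≡ fsuc i → Edge G u w
    viaFirst (inj₁ (refl , refl)) l = noConflict⇒adjacent L freeB e₂ l
    viaFirst (inj₂ (refl , refl)) l = noConflict⇒adjacent L freeA e₂ l
  ... | no _   | yes s₂ = viaSecond s₂ (trans (labSym L v u) (trans l₁ (sym l₂)))
    where
    viaSecond : SameEdge (v , w) (a , b) → lab L v u ≡ fsuc i → Edge G u w
    viaSecond (inj₁ (refl , refl)) l = edge-sym G (noConflict⇒adjacent L freeA (edge-sym G e₁) l)
    viaSecond (inj₂ (refl , refl)) l = edge-sym G (noConflict⇒adjacent L freeB (edge-sym G e₁) l)
  ... | no _   | no _   = stc u v w j u≢w e₁ e₂ l₁ l₂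

injection-into-list : ∀ {X : Set} {m} (h : Fin m → X) (xs : List X)
  → Injective _≡_ _≡_ h → (∀ i → h i ∈ xs) → m ≤ length xs
injection-into-list h xs h-inj member = injective⇒≤ position-injective
  where
  position-injective : Injective _≡_ _≡_ (λ i → index (member i))
  position-injective {i} {i'} same = h-inj (begin
      h i                          ≡⟨ lookup-index (member i) ⟩
      lookup xs (index (member i)) ≡⟨ cong (lookup xs) same ⟩
      lookup xs (index (member i')) ≡⟨ sym (lookup-index (member i')) ⟩
      h i'                         ∎)
    where open ≡-Reasoning

⧺-injective : ∀ {X : Set} {m k} {f : Fin m → X} {g : Fin k → X}
  → Injective _≡_ _≡_ f → Injective _≡_ _≡_ g → (∀ i j → f i ≢ g j) → Injective _≡_ _≡_ (f ⧺ g)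
⧺-injective {m = m} {k} {f} {g} f-inj g-inj disjoint {x} {y} same = begin
    x                        ≡⟨ sym (join-splitAt m k x) ⟩
    join m k (splitAt m x)   ≡⟨ cong (join m k) (halves (splitAt m x) (splitAt m y) same) ⟩
    join m k (splitAt m y)   ≡⟨ join-splitAt m k y ⟩
    y                        ∎
  where
  open ≡-Reasoning
  halves : ∀ s t → [ f , g ]′ s ≡ [ f , g ]′ t → s ≡ t
  halves (inj₁ i) (inj₁ i') eq = cong inj₁ (f-inj eq)
  halves (inj₁ i) (inj₂ j)  eq = ⊥-elim (disjoint i j eq)
  halves (inj₂ j) (inj₁ i)  eq = ⊥-elim (disjoint i j (sym eq))
  halves (inj₂ j) (inj₂ j') eq = cong inj₂ (g-inj eq)

length-filterᵇ : ∀ {X : Set} (p : X → Bool) xs → length (filterᵇ p xs) ≡ sum (map (indicator ∘ p) xs)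
length-filterᵇ p []       = refl
length-filterᵇ p (x ∷ xs) with p x
... | true  = cong suc (length-filterᵇ p xs)
... | false = length-filterᵇ p xs

module Slots {n : ℕ} (G : Graph n) (a b : Fin n) where

  -- A slot names an edge at a (inj₁ w stands for {a,w}) or at b (inj₂ w for {b,w}).
  Slot : Set
  Slot = Fin n ⊎ Fin n

  IsEdgeSlot : Slot → Set
  IsEdgeSlot (inj₁ w) = Edge G a w
  IsEdgeSlot (inj₂ w) = Edge G b w

  neighbours : Fin n → List (Fin n)
  neighbours v = filterᵇ (adj G v) (allFin n)

  slots : List Slot
  slots = map inj₁ (neighbours a) ++ map inj₂ (neighbours b)

  slots-length : length slots ≡ count (adj G a) + count (adj G b)
  slots-length = trans (length-++ (map inj₁ (neighbours a)))
    (cong₂ _+_ (trans (length-map inj₁ (neighbours a)) (length-filterᵇ (adj G a) (allFin n)))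
               (trans (length-map inj₂ (neighbours b)) (length-filterᵇ (adj G b) (allFin n))))

  ∈-slots : ∀ z → IsEdgeSlot z → z ∈ slots
  ∈-slots (inj₁ w) e = ∈-++⁺ˡ (∈-map⁺ inj₁ (∈-filter⁺ (T? ∘ adj G a) (∈-allFin w) e))
  ∈-slots (inj₂ w) e = ∈-++⁺ʳ (map inj₁ (neighbours a)) (∈-map⁺ inj₂ (∈-filter⁺ (T? ∘ adj G b) (∈-allFin w) e))

  edgeSlots-bound : ∀ {m} (h : Fin m → Slot) → Injective _≡_ _≡_ h → (∀ i → IsEdgeSlot (h i))
    → m ≤ count (adj G a) + count (adj G b)
  edgeSlots-bound h h-inj edge =
    ≤-trans (injection-into-list h slots h-inj (λ i → ∈-slots (h i) (edge i))) (≤-reflexive slots-length)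

module FreeColour {n : ℕ} (G : Graph n) {c : ℕ} where
  open Closure G {c}

  -- If {a,b} and {b,d} are weak edges and deg a + deg b ≤ c + 2, some colour
  -- is free for {a,b}: otherwise the c conflicts (one per colour, pairwise
  -- distinct because their colours differ) together with the weak slots
  -- {a,b} at a, {b,a} at b and {b,d} at b give c + 3 distinct edge slots.
  freeColour : ∀ (M : Labeling n c) {a b d} → Edge G a b → Edge G b d → d ≢ a
    → lab M a b ≡ fzero → lab M b d ≡ fzero
    → count (adj G a) + count (adj G b) ≤ c + 2
    → Σ[ i ∈ Fin c ] Free M a b i
  freeColour M {a} {b} {d} ab bd d≢a ab-weak bd-weak degrees with any? (free? M a b)
  ... | yes found = found
  ... | no none   = ⊥-elim (<-irrefl (+-comm 2 c) (≤-trans tooManySlots degrees))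
    where
    open Slots G a b

    slotLabel : Slot → Fin (suc c)
    slotLabel (inj₁ w) = lab M a w
    slotLabel (inj₂ w) = lab M b w

    ColouredSlot : Fin c → Set
    ColouredSlot i = Σ[ z ∈ Slot ] (IsEdgeSlot z × slotLabel z ≡ fsuc i)

    conflictSlot : ∀ i → ConflictAt M a b i ⊎ ConflictAt M b a i → ColouredSlot i
    conflictSlot i (inj₁ (w , e , l , _)) = inj₁ w , e , l
    conflictSlot i (inj₂ (w , e , l , _)) = inj₂ w , e , l

    coloured : ∀ i → ColouredSlot i
    coloured i = conflictSlot i (notFree⇒conflict M a b i (λ free → none (i , free)))

    weakSlot : Fin 3 → Slot
    weakSlot fzero               = inj₁ b
    weakSlot (fsuc fzero)        = inj₂ a
    weakSlot (fsuc (fsuc fzero)) = inj₂ d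

    weakSlot-edge : ∀ k → IsEdgeSlot (weakSlot k)
    weakSlot-edge fzero               = ab
    weakSlot-edge (fsuc fzero)        = edge-sym G ab
    weakSlot-edge (fsuc (fsuc fzero)) = bd

    weakSlot-weak : ∀ k → slotLabel (weakSlot k) ≡ fzero
    weakSlot-weak fzero               = ab-weak
    weakSlot-weak (fsuc fzero)        = trans (labSym M b a) ab-weak
    weakSlot-weak (fsuc (fsuc fzero)) = bd-weak

    weakSlot-injective : Injective _≡_ _≡_ weakSlot
    weakSlot-injective {fzero}               {fzero}               _ = refl
    weakSlot-injective {fsuc fzero}          {fsuc fzero}          _ = refl
    weakSlot-injective {fsuc (fsuc fzero)}   {fsuc (fsuc fzero)}   _ = refl
    weakSlot-injective {fsuc fzero}          {fsuc (fsuc fzero)} refl = ⊥-elim (d≢a refl)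
    weakSlot-injective {fsuc (fsuc fzero)}   {fsuc fzero}        refl = ⊥-elim (d≢a refl)
    weakSlot-injective {fzero}               {fsuc fzero}          ()
    weakSlot-injective {fzero}               {fsuc (fsuc fzero)}   ()
    weakSlot-injective {fsuc fzero}          {fzero}               ()
    weakSlot-injective {fsuc (fsuc fzero)}   {fzero}               ()

    colouredSlot : Fin c → Slot
    colouredSlot i = proj₁ (coloured i)

    colour-of : ∀ i → slotLabel (colouredSlot i) ≡ fsuc i
    colour-of i = proj₂ (proj₂ (coloured i))

    colouredSlot-injective : Injective _≡_ _≡_ colouredSlot
    colouredSlot-injective {i} {i'} same =
      fsuc-injective (trans (sym (colour-of i)) (trans (cong slotLabel same) (colour-of i')))

    weak≢coloured : ∀ k i → weakSlot k ≢ colouredSlot i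
    weak≢coloured k i same with () ← trans (sym (weakSlot-weak k)) (trans (cong slotLabel same) (colour-of i))

    allSlots : Fin (3 + c) → Slot
    allSlots = weakSlot ⧺ colouredSlot

    allSlots-edge : ∀ x → IsEdgeSlot (allSlots x)
    allSlots-edge x with splitAt 3 x
    ... | inj₁ k = weakSlot-edge k
    ... | inj₂ i = proj₁ (proj₂ (coloured i))

    tooManySlots : 3 + c ≤ count (adj G a) + count (adj G b)
    tooManySlots = edgeSlots-bound allSlots
      (⧺-injective weakSlot-injective colouredSlot-injective weak≢coloured) allSlots-edge

module Exchange {n : ℕ} (G : Graph n) {c : ℕ} where
  open WeakCount G {c}
  open Closure G {c}
  open FreeColour G {c}

  AgreeOff : Labeling n c → Labeling n c → Fin n × Fin n → Fin n × Fin n → Set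
  AgreeOff L L' e f = ∀ u v → ¬ SameEdge (u , v) e → ¬ SameEdge (u , v) f → lab L u v ≡ lab L' u v

  Shifted : Labeling n c → Fin n → Fin n → Fin n → Set
  Shifted L a b d = Σ[ L' ∈ Labeling n c ] (IsSTC G L' × AgreeOff L L' (a , b) (b , d)
    × lab L' a b ≡ lab L b d × lab L' b d ≡ fzero × weakCount G L' ≡ weakCount G L)

  Improved : Labeling n c → Fin n → Fin n → Fin n → Set
  Improved L a b d = Σ[ L' ∈ Labeling n c ] (IsSTC G L' × AgreeOff L L' (a , b) (b , d)
    × weakCount G L' < weakCount G L)

  -- The exchange when {b,d} is strong with colour j: weaken {b,d}; the
  -- pigeonhole lemma yields a colour i free for {a,b}.  If i = j, give it to
  -- {a,b}; otherwise i was already free in L and colouring {a,b} with it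
  -- removes a weak edge.
  exchangeStrong : ∀ L {a b d j} → IsSTC G L → count (adj G a) + count (adj G b) ≤ c + 2
    → Edge G a b → Edge G b d → d ≢ a → lab L a b ≡ fzero → lab L b d ≡ fsuc j
    → Shifted L a b d ⊎ Improved L a b d
  exchangeStrong L {a} {b} {d} {j} stc degrees ab bd d≢a ab-weak bd-strong =
    fromFree (freeColour Lm ab bd d≢a Lm-ab-weak (relabel-ab L b d fzero) degrees)
    where
    Lm : Labeling n c
    Lm = relabel L b d fzero

    ab≉bd : ¬ SameEdge (a , b) (b , d)
    ab≉bd (inj₁ (a≡b , _)) = edge-irrefl G ab a≡b
    ab≉bd (inj₂ (a≡d , _)) = d≢a (sym a≡d)

    Lm-ab-weak : lab Lm a b ≡ fzero
    Lm-ab-weak = trans (sym (relabel-elsewhere L b d fzero ab≉bd)) ab-weak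

    shifted : Free Lm a b j → Shifted L a b d
    shifted free = L₁ , stc₁ , agree , ab-label , bd-weak , sameCount
      where
      L₁ : Labeling n c
      L₁ = relabel Lm a b (fsuc j)
      stc₁ : IsSTC G L₁
      stc₁ = recolour-STC Lm a b j (weaken-STC L b d stc) free
      agree : AgreeOff L L₁ (a , b) (b , d)
      agree u v s₁ s₂ = trans (relabel-elsewhere L b d fzero s₂) (relabel-elsewhere Lm a b (fsuc j) s₁)
      ab-label : lab L₁ a b ≡ lab L b d
      ab-label = trans (relabel-ab Lm a b (fsuc j)) (sym bd-strong)
      bd-weak : lab L₁ b d ≡ fzero
      bd-weak = trans (sym (relabel-elsewhere Lm a b (fsuc j) (ab≉bd ∘ sameEdge-sym)))
                      (relabel-ab L b d fzero)
      sameCount : weakCount G L₁ ≡ weakCount G L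
      sameCount = suc-injective (trans (weakCount-strengthen Lm j ab Lm-ab-weak)
                                       (weakCount-weaken L j bd bd-strong))

    improved : ∀ i → Free L a b i → Improved L a b d
    improved i free = L₂ , recolour-STC L a b i stc free , agree , fewer
      where
      L₂ : Labeling n c
      L₂ = relabel L a b (fsuc i)
      agree : AgreeOff L L₂ (a , b) (b , d)
      agree u v s₁ _ = relabel-elsewhere L a b (fsuc i) s₁
      fewer : weakCount G L₂ < weakCount G L
      fewer = ≤-reflexive (weakCount-strengthen L i ab ab-weak)

    freeBefore : ∀ {i} → i ≢ j → Free Lm a b i → Free L a b i
    freeBefore {i} i≢j (freeA , freeB) =
      (λ conflict → freeA (conflict-transfer L Lm keep conflict)) ,
      (λ conflict → freeB (conflict-transfer L Lm keep conflict))
      where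
      keep : ∀ {u v} → lab L u v ≡ fsuc i → lab Lm u v ≡ fsuc i
      keep = weaken-keeps-colour L b d (λ bd-i → i≢j (fsuc-injective (trans (sym bd-i) bd-strong)))

    fromFree : Σ[ i ∈ Fin c ] Free Lm a b i → Shifted L a b d ⊎ Improved L a b d
    fromFree (i , free) with i ≟F j
    ... | yes refl = inj₁ (shifted free)
    ... | no i≢j   = inj₂ (improved i (freeBefore i≢j free))

  exchange : ∀ L {a b d} → IsSTC G L → count (adj G a) + count (adj G b) ≤ c + 2
    → Edge G a b → Edge G b d → d ≢ a → lab L a b ≡ fzero
    → Shifted L a b d ⊎ Improved L a b d
  exchange L {a} {b} {d} stc degrees ab bd d≢a ab-weak = byLabel (lab L b d) refl
    where
    byLabel : ∀ x → lab L b d ≡ x → Shifted L a b d ⊎ Improved L a b d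
    byLabel fzero    bd-weak   =
      inj₁ (L , stc , (λ _ _ _ _ → refl) , trans ab-weak (sym bd-weak) , bd-weak , refl)
    byLabel (fsuc j) bd-strong = exchangeStrong L stc degrees ab bd d≢a ab-weak bd-strong

-- A periphery vertex has no D-edges, so its degree in G is its degree in
-- (V, E ∖ D), which is at most ⌊c/2⌋ + 1.
periphery-degree : ∀ {n} (G : Graph n) c D → ValidD G c D
  → ∀ v → InPeriphery D v → count (adj G v) ≤ c / 2 + 1
periphery-degree G c D (_ , _ , bounded) v outside =
  ≤-trans (≤-reflexive (sumOver-cong noCoreEdge)) (bounded v)
  where
  noCoreEdge : ∀ w → indicator (adj G v w) ≡ indicator (adj G v w ∧ not (D v w))
  noCoreEdge w with D v w in vw∈D
  ... | true  = ⊥-elim (outside (w , subst T (sym vw∈D) _))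
  ... | false = cong indicator (sym (∧-identityʳ (adj G v w)))

twice-half : ∀ c → (c / 2 + 1) + (c / 2 + 1) ≤ c + 2
twice-half c = ≤-trans (≤-reflexive (double (c / 2))) (+-monoˡ-≤ 2 (m/n*n≤m c 2))
  where
  double : ∀ h → (h + 1) + (h + 1) ≡ h * 2 + 2
  double = solve 1 (λ h → (h :+ con 1) :+ (h :+ con 1) := h :* con 2 :+ con 2) refl

module Shifting {n : ℕ} (G : Graph n) {c : ℕ} (A : Fin n → Set)
                (lowDegree : ∀ v → A v → count (adj G v) ≤ c / 2 + 1) where
  open Exchange G {c}

  ShiftOrImprove : Labeling n c → List (Fin n) → Set
  ShiftOrImprove L P = Σ[ L' ∈ Labeling n c ] (IsSTC G L' × PartEqOff G P L L'
    × (colorSeq L' P ≡ drop 1 (colorSeq L P) ++ [ fzero ] ⊎ weakCount G L' < weakCount G L))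

  colours-unchanged : ∀ L L' {e f} → AgreeOff L L' e f → (es : List (Fin n × Fin n))
    → All (λ g → ¬ SameEdge e g) es → All (λ g → ¬ SameEdge f g) es
    → map (λ g → lab L' (proj₁ g) (proj₂ g)) es ≡ map (λ g → lab L (proj₁ g) (proj₂ g)) es
  colours-unchanged L L' agree []             []         []         = refl
  colours-unchanged L L' agree ((u , v) ∷ es) (≉e ∷ ≉es) (≉f ∷ ≉fs) =
    cong₂ _∷_ (sym (agree u v (≉e ∘ sameEdge-sym) (≉f ∘ sameEdge-sym))) (colours-unchanged L L' agree es ≉es ≉fs)

  -- Induction along the path: exchange at the first two edges, then shift
  -- the remaining path starting from the (now weak) second edge.
  shiftAlong : ∀ L → IsSTC G L → ∀ v₁ v₂ rest
    → WalkIn G A (v₁ ∷ v₂ ∷ rest) → EdgeSimple (v₁ ∷ v₂ ∷ rest) → lab L v₁ v₂ ≡ fzero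
    → ShiftOrImprove L (v₁ ∷ v₂ ∷ rest)
  shiftAlong L stc v₁ v₂ [] _ _ weak = L , stc , (λ _ _ _ _ → refl) , inj₁ (cong [_] weak)
  shiftAlong L stc v₁ v₂ (v₃ ∷ rest) (A₁ ∷ A₂ ∷ As , e₁₂ ∷ e₂₃ ∷ es)
             ((12≉23 ∷ 12≉rest) ∷ simple₂@(23≉rest ∷ _)) weak
    with exchange L stc degrees e₁₂ e₂₃ v₃≢v₁ weak
    where
    degrees : count (adj G v₁) + count (adj G v₂) ≤ c + 2
    degrees = ≤-trans (+-mono-≤ (lowDegree v₁ A₁) (lowDegree v₂ A₂)) (twice-half c)
    v₃≢v₁ : v₃ ≢ v₁
    v₃≢v₁ refl = 12≉23 (inj₂ (refl , refl))
  ... | inj₂ (L₂ , stc₂ , agree , fewer) =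
    L₂ , stc₂ , (λ u v _ off → agree u v (off ∘ here) (off ∘ there ∘ here)) , inj₂ fewer
  ... | inj₁ (L₁ , stc₁ , agree , ab-label , bd-weak , sameCount)
    with shiftAlong L₁ stc₁ v₂ v₃ rest (A₂ ∷ As , e₂₃ ∷ es) simple₂ bd-weak
  ... | L' , stc' , partEq' , outcome = L' , stc' , partEq , combine outcome
    where
    partEq : PartEqOff G (v₁ ∷ v₂ ∷ v₃ ∷ rest) L L'
    partEq u v e off = trans (agree u v (off ∘ here) (off ∘ there ∘ here)) (partEq' u v e (off ∘ there))

    firstColour : lab L' v₁ v₂ ≡ lab L v₂ v₃
    firstColour = trans (sym (partEq' v₁ v₂ e₁₂ (All¬⇒¬Any (12≉23 ∷ 12≉rest)))) ab-label

    combine : colorSeq L' (v₂ ∷ v₃ ∷ rest) ≡ drop 1 (colorSeq L₁ (v₂ ∷ v₃ ∷ rest)) ++ [ fzero ]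
                ⊎ weakCount G L' < weakCount G L₁
            → colorSeq L' (v₁ ∷ v₂ ∷ v₃ ∷ rest) ≡ drop 1 (colorSeq L (v₁ ∷ v₂ ∷ v₃ ∷ rest)) ++ [ fzero ]
                ⊎ weakCount G L' < weakCount G L
    combine (inj₂ fewer)  = inj₂ (subst (weakCount G L' <_) sameCount fewer)
    combine (inj₁ shifted) = inj₁ (cong₂ _∷_ firstColour (begin
        colorSeq L' (v₂ ∷ v₃ ∷ rest)         ≡⟨ shifted ⟩
        colorSeq L₁ (v₃ ∷ rest) ++ [ fzero ] ≡⟨ cong (_++ [ fzero ]) (colours-unchanged L L₁ agree _ 12≉rest 23≉rest) ⟩
        colorSeq L (v₃ ∷ rest) ++ [ fzero ]  ∎))
      where open ≡-Reasoning

-- Lemma 21: periphery vertices have degree ≤ ⌊c/2⌋ + 1, so shiftAlong applies.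
lemma21 : ∀ {n : ℕ} (G : Graph n) (c k : ℕ) (D : Fin n → Fin n → Bool)
    → ValidD G c D
    → (A : Fin n → Set) → (∀ v → A v → InPeriphery D v)
    → (L : Labeling n c) → IsSTC G L
    → (v₁ v₂ : Fin n) (rest : List (Fin n))
    → WalkIn G A (v₁ ∷ v₂ ∷ rest) → EdgeSimple (v₁ ∷ v₂ ∷ rest)
    → lab L v₁ v₂ ≡ fzero
    → Σ[ L' ∈ Labeling n c ] (IsSTC G L'
        × PartEqOff G (v₁ ∷ v₂ ∷ rest) L L'
        × (colorSeq L' (v₁ ∷ v₂ ∷ rest) ≡ drop 1 (colorSeq L (v₁ ∷ v₂ ∷ rest)) ++ [ fzero ]
           ⊎ weakCount G L' < weakCount G L))
lemma21 G c k D validD A A⊆periphery L stc v₁ v₂ rest walk simple weak =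
  shiftAlong L stc v₁ v₂ rest walk simple weak
  where
  open Shifting G {c} A (λ v Av → periphery-degree G c D validD v (A⊆periphery v Av))
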